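{- Let $H$ be an $r$-partite hypergraph with at least one edge. Then there exist an edge $e\in H$ and a vertex $v\in e$ such that, with $S=e\setminus\{v\}$, we have $\nu^*(H-S)\le\nu^*(H)-1$.
   Context: A hypergraph is $r$-partite if its vertex set can be partitioned into $r$ sets (the sides) so that every edge contains exactly one vertex from each side. $H-S$ denotes the hypergraph obtained by deleting the vertices of $S$, i.e., consisting of the edges of $H$ disjoint from $S$. $\nu^*(H)$ is the fractional matching number: the maximum of $\sum_{e\in H}w_e$ over nonnegative weights $w_e$ on edges such that for every vertex the sum of weights of edges containing it is at most $1$ (by LP duality this equals the fractional covering number $\tau^*(H)$). -}

module Defs where

open import Data.Nat using (ℕ; zero; suc)
open import Data.Bool using (Bool; true; false; if_then_else_; _∧_; not)
open import Data.Fin using (Fin)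
open import Data.Fin.Subset using (Subset)
open import Data.Vec as Vec using (Vec; lookup)
open import Data.List using (List; length; filterᵇ)
import Data.List as List
open import Data.Product using (Σ; _×_; ∃)
open import Data.Rational using (ℚ; 0ℚ; 1ℚ; _+_; _≤_)
open import Relation.Binary.PropositionalEquality using (_≡_)
open import Data.List.Membership.Propositional as LM using ()

sumFin : (m : ℕ) → (Fin m → ℚ) → ℚ
sumFin zero    f = 0ℚ
sumFin (suc m) f = f Fin.zero + sumFin m (λ i → f (Fin.suc i))
  where import Data.Fin as Fin

Hypergraph : ℕ → Set
Hypergraph n = List (Subset n)

IsRPartite : {n : ℕ} → (r : ℕ) → Hypergraph n → Set
IsRPartite {n} r H =
  Σ (Fin n → Fin r) λ side →
    ∀ e → e LM.∈ H → ∀ (i : Fin r) →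
      Σ (Fin n) λ v → (v Data.Fin.Subset.∈ e) × (side v ≡ i) ×
        (∀ u → u Data.Fin.Subset.∈ e → side u ≡ i → u ≡ v)

Weighting : {n : ℕ} → Hypergraph n → Set
Weighting H = Fin (length H) → ℚ

load : {n : ℕ} (H : Hypergraph n) → Weighting H → Fin n → ℚ
load H w v = sumFin (length H) (λ i → if lookup (List.lookup H i) v then w i else 0ℚ)

total : {n : ℕ} (H : Hypergraph n) → Weighting H → ℚ
total H w = sumFin (length H) w

IsFracMatching : {n : ℕ} (H : Hypergraph n) → Weighting H → Set
IsFracMatching {n} H w = (∀ i → 0ℚ ≤ w i) × (∀ (v : Fin n) → load H w v ≤ 1ℚ)

IsFracMatchingNumber : {n : ℕ} (H : Hypergraph n) → ℚ → Set
IsFracMatchingNumber H x =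
  (Σ (Weighting H) λ w → IsFracMatching H w × total H w ≡ x) ×
  (∀ (w : Weighting H) → IsFracMatching H w → total H w ≤ x)

disjointᵇ : {n : ℕ} → Subset n → Subset n → Bool
disjointᵇ e S = Vec.foldr _ (λ b acc → not b ∧ acc) true (Vec.zipWith _∧_ e S)

_-ᴴ_ : {n : ℕ} → Hypergraph n → Subset n → Hypergraph n
H -ᴴ S = filterᵇ (λ e → disjointᵇ e S) H

module Submission where

-- By LP duality ν*(H) = τ*(H), so there is a fractional cover t of H of weight at
-- most ν*(H).  Take two sides A, B of H (vertices lying in some edge only) with |A| ≥ |B|, and a
-- vertex u ∈ A minimising t on A.  Every edge meets A and B exactly once, so moving the weight t u
-- off every vertex of A and onto every vertex of B yields a cover t' that is no heavier and
-- vanishes at u.  For an edge e ∋ u and S = e ∖ {u}, t' set to 0 on S covers H - S and weighs at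
-- most Σ t' - t'(e) ≤ ν*(H) - 1; weak duality then bounds ν*(H - S).

open import Defs
open import Function using (_∘_)
open import Function.Bundles using (Equivalence)
open import Data.Empty using (⊥-elim)
open import Data.Unit using (⊤; tt)
open import Data.Product using (Σ; _×_; _,_; proj₁; proj₂)
open import Data.Sum using (_⊎_; inj₁; inj₂)
open import Relation.Nullary using (¬_; yes; no; does)
open import Relation.Nullary.Decidable using (T?)
open import Relation.Binary using (tri<; tri≈; tri>)
open import Relation.Binary.PropositionalEquality
open import Data.Bool using (Bool; true; false; if_then_else_; _∧_; T)
open import Data.Bool.Properties using (T-≡)
open import Data.Bool.ListAction using (any)
open import Data.Nat using (ℕ; zero; suc; s≤s)
import Data.Nat as ℕ
open import Data.Fin using (Fin) renaming (zero to fz; suc to fs)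
open import Data.Fin.Properties using (suc-injective) renaming (_≟_ to _≟F_)
open import Data.Fin.Subset using (Subset; _─_; ⁅_⁆; _∈_)
open import Data.Fin.Subset.Properties using (x≢y⇒x∉⁅y⁆)
open import Data.Vec using (_∷_; lookup)
open import Data.Vec.Properties using (lookup⇒[]=; []=⇒lookup)
open import Data.List using (List; []; _∷_; _++_; map; tabulate; length)
import Data.List as List
open import Data.List.Membership.Propositional using (find) renaming (_∈_ to _∈ᴸ_)
open import Data.List.Membership.Propositional.Properties using (∈-lookup; ∈-filter⁻)
open import Data.List.Relation.Unary.Any as Any using (index)
open import Data.List.Relation.Unary.Any.Properties using (lookup-index; any⁺; any⁻)
open import Data.List.Relation.Unary.All as All using (All; []; _∷_)
import Data.List.Relation.Unary.All.Properties as AllP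
open import Data.Rational using (ℚ; 0ℚ; 1ℚ; _+_; _*_; _-_; -_; _≤_; _<_; _⊔_; _⊓_; 1/_; positive; nonNegative)
open import Data.Rational.Properties
open import Data.Rational.Solver
open +-*-Solver using (solve; _:+_; _:*_; _:-_; :-_; _:=_; con)

sumFin-cong : ∀ m {f g : Fin m → ℚ} → (∀ i → f i ≡ g i) → sumFin m f ≡ sumFin m g
sumFin-cong zero    h = refl
sumFin-cong (suc m) h = cong₂ _+_ (h fz) (sumFin-cong m (λ i → h (fs i)))

sumFin-0 : ∀ m → sumFin m (λ _ → 0ℚ) ≡ 0ℚ
sumFin-0 zero    = refl
sumFin-0 (suc m) = trans (+-identityˡ _) (sumFin-0 m)

sumFin-+ : ∀ m (f g : Fin m → ℚ) → sumFin m (λ i → f i + g i) ≡ sumFin m f + sumFin m g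
sumFin-+ zero    f g = refl
sumFin-+ (suc m) f g =
  trans (cong (f fz + g fz +_) (sumFin-+ m (λ i → f (fs i)) (λ i → g (fs i))))
        (solve 4 (λ a b c d → (a :+ b) :+ (c :+ d) := (a :+ c) :+ (b :+ d)) refl (f fz) (g fz) _ _)

sumFin-* : ∀ m c (f : Fin m → ℚ) → sumFin m (λ i → c * f i) ≡ c * sumFin m f
sumFin-* zero    c f = sym (*-zeroʳ c)
sumFin-* (suc m) c f = trans (cong (c * f fz +_) (sumFin-* m c (λ i → f (fs i))))
                             (sym (*-distribˡ-+ c (f fz) _))

sumFin-neg : ∀ m (f : Fin m → ℚ) → sumFin m (λ i → - f i) ≡ - sumFin m f
sumFin-neg zero    f = refl
sumFin-neg (suc m) f = trans (cong (- f fz +_) (sumFin-neg m (λ i → f (fs i))))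
                             (sym (neg-distrib-+ (f fz) _))

sumFin-swap : ∀ m k (f : Fin m → Fin k → ℚ) →
  sumFin m (λ i → sumFin k (f i)) ≡ sumFin k (λ u → sumFin m (λ i → f i u))
sumFin-swap zero    k f = sym (sumFin-0 k)
sumFin-swap (suc m) k f = trans (cong (sumFin k (f fz) +_) (sumFin-swap m k (λ i → f (fs i))))
                                (sym (sumFin-+ k (f fz) (λ u → sumFin m (λ i → f (fs i) u))))

sumFin-mono : ∀ m {f g : Fin m → ℚ} → (∀ i → f i ≤ g i) → sumFin m f ≤ sumFin m g
sumFin-mono zero    h = ≤-refl
sumFin-mono (suc m) h = +-mono-≤ (h fz) (sumFin-mono m (λ i → h (fs i)))

sumFin-nonneg : ∀ m {f : Fin m → ℚ} → (∀ i → 0ℚ ≤ f i) → 0ℚ ≤ sumFin m f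
sumFin-nonneg m {f} h = subst (_≤ sumFin m f) (sumFin-0 m) (sumFin-mono m h)

sumFin-term : ∀ m {f : Fin m → ℚ} → (∀ i → 0ℚ ≤ f i) → ∀ j → f j ≤ sumFin m f
sumFin-term (suc m) {f} h fz =
  subst (_≤ f fz + sumFin m (λ i → f (fs i))) (+-identityʳ (f fz))
        (+-monoʳ-≤ (f fz) (sumFin-nonneg m (λ i → h (fs i))))
sumFin-term (suc m) {f} h (fs j) =
  ≤-trans (sumFin-term m (λ i → h (fs i)) j)
          (subst (_≤ f fz + sumFin m (λ i → f (fs i))) (+-identityˡ _)
                 (+-monoˡ-≤ (sumFin m (λ i → f (fs i))) (h fz)))

sumFin-point : ∀ m (f : Fin m → ℚ) (j : Fin m) → (∀ i → ¬ i ≡ j → f i ≡ 0ℚ) → sumFin m f ≡ f j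
sumFin-point (suc m) f fz h =
  trans (cong (f fz +_) (trans (sumFin-cong m (λ i → h (fs i) (λ ()))) (sumFin-0 m))) (+-identityʳ _)
sumFin-point (suc m) f (fs j) h =
  trans (cong (_+ sumFin m (λ i → f (fs i))) (h fz (λ ())))
        (trans (+-identityˡ _) (sumFin-point m (λ i → f (fs i)) j (λ i i≢j → h (fs i) (i≢j ∘ suc-injective))))

0≤1 : 0ℚ ≤ 1ℚ
0≤1 = <⇒≤ (positive⁻¹ 1ℚ)

*-nonneg : ∀ {c x} → 0ℚ ≤ c → 0ℚ ≤ x → 0ℚ ≤ c * x
*-nonneg {c} {x} hc hx = subst (_≤ c * x) (*-zeroʳ c) (*-monoˡ-≤-nonNeg c {{nonNegative hc}} hx)

*-monoˡ-≤-≥0 : ∀ {c p q} → 0ℚ ≤ c → p ≤ q → c * p ≤ c * q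
*-monoˡ-≤-≥0 {c} hc = *-monoˡ-≤-nonNeg c {{nonNegative hc}}

neg-cancel-≤ : ∀ {p q} → - p ≤ - q → q ≤ p
neg-cancel-≤ {p} {q} h = subst₂ _≤_
  (solve 2 (λ p q → :- p :+ (p :+ q) := q) refl p q)
  (solve 2 (λ p q → :- q :+ (p :+ q) := p) refl p q)
  (+-monoˡ-≤ (p + q) h)

recip : (p : ℚ) → 0ℚ < p → ℚ
recip p h = (1/ p) {{pos⇒nonZero p {{positive h}}}}

recip-pos : ∀ p h → 0ℚ < recip p h
recip-pos p h = positive⁻¹ (recip p h) {{1/pos⇒pos p {{positive h}}}}

recip-* : ∀ p h → recip p h * p ≡ 1ℚ
recip-* p h = *-inverseˡ p {{pos⇒nonZero p {{positive h}}}}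

ind : Bool → ℚ → ℚ
ind b q = if b then q else 0ℚ

ind-nonneg : ∀ b {q} → 0ℚ ≤ q → 0ℚ ≤ ind b q
ind-nonneg true  h = h
ind-nonneg false h = ≤-refl

ind-0 : ∀ b → ind b 0ℚ ≡ 0ℚ
ind-0 true  = refl
ind-0 false = refl

ind-* : ∀ b c q → ind b (c * q) ≡ c * ind b q
ind-* true  c q = refl
ind-* false c q = sym (*-zeroʳ c)

ind-+ : ∀ b p q → ind b (p + q) ≡ ind b p + ind b q
ind-+ true  p q = refl
ind-+ false p q = refl

unit : ∀ {m} → Fin m → Fin m → ℚ
unit j i = ind (does (i ≟F j)) 1ℚ

unit-self : ∀ {m} (j : Fin m) → unit j j ≡ 1ℚ
unit-self j with j ≟F j
... | yes _  = refl
... | no j≢j = ⊥-elim (j≢j refl)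

unit-other : ∀ {m} (j i : Fin m) → ¬ i ≡ j → unit j i ≡ 0ℚ
unit-other j i i≢j with i ≟F j
... | yes i≡j = ⊥-elim (i≢j i≡j)
... | no _    = refl

unit-nonneg : ∀ {m} (j i : Fin m) → 0ℚ ≤ unit j i
unit-nonneg j i = ind-nonneg (does (i ≟F j)) 0≤1

sumFin-unit : ∀ m (j : Fin m) (f : Fin m → ℚ) → sumFin m (λ i → unit j i * f i) ≡ f j
sumFin-unit m j f =
  trans (sumFin-point m _ j (λ i i≢j → trans (cong (_* f i) (unit-other j i i≢j)) (*-zeroˡ (f i))))
        (trans (cong (_* f j) (unit-self j)) (*-identityˡ (f j)))

lowerBound : (us : List ℚ) → Σ ℚ λ v → All (v ≤_) us
lowerBound []       = 0ℚ , []
lowerBound (u ∷ us) with lowerBound us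
... | v , v≤us = u ⊓ v , p⊓q≤p u v ∷ All.map (≤-trans (p⊓q≤q u v)) v≤us

-- Lower bounds all lying below upper bounds leave room for a common value between them
-- (the one-dimensional step of Fourier–Motzkin elimination).
between : (ls us : List ℚ) → All (λ u → All (_≤ u) ls) us →
  Σ ℚ λ v → All (_≤ v) ls × All (v ≤_) us
between []       us _ with lowerBound us
... | v , v≤us = v , [] , v≤us
between (l ∷ ls) us h with between ls us (All.map All.tail h)
... | v , ls≤v , v≤us =
  l ⊔ v , p≤p⊔q l v ∷ All.map (λ l'≤v → ≤-trans l'≤v (p≤q⊔p l v)) ls≤v ,
  All.zipWith (λ (l≤u , v≤u) → ⊔-lub l≤u v≤u) (All.map All.head h , v≤us)

-- Eliminating a variable j produces a system without j such that (i) every solution of the new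
-- system extends, by changing x j only, to a solution of the old one, and (ii) every new row is a
-- positive combination of old rows, so any property of rows closed under such combinations is kept.
module FourierMotzkin (K : ℕ) where

  record Row : Set where
    constructor row
    field
      a : Fin K → ℚ
      b : ℚ
  open Row public

  dot : (Fin K → ℚ) → (Fin K → ℚ) → ℚ
  dot c x = sumFin K (λ i → c i * x i)

  Sat : (Fin K → ℚ) → Row → Set
  Sat x r = dot (a r) x ≤ b r

  scale : ℚ → Row → Row
  scale c r = row (λ i → c * a r i) (c * b r)

  add : Row → Row → Row
  add r s = row (λ i → a r i + a s i) (b r + b s)

  record Closed (Q : Row → Set) : Set where
    field
      scale-closed : ∀ c r → 0ℚ < c → Q r → Q (scale c r)
      add-closed   : ∀ r s → Q r → Q s → Q (add r s)
  open Closed public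

  closed-⊤ : Closed (λ _ → ⊤)
  closed-⊤ = record { scale-closed = λ _ _ _ _ → tt ; add-closed = λ _ _ _ _ → tt }

  closed-× : ∀ {Q R} → Closed Q → Closed R → Closed (λ r → Q r × R r)
  closed-× cQ cR = record
    { scale-closed = λ c r hc (q , q') → scale-closed cQ c r hc q , scale-closed cR c r hc q'
    ; add-closed   = λ r s (q , q') (p , p') → add-closed cQ r s q p , add-closed cR r s q' p' }

  closed-zero : ∀ i → Closed (λ r → a r i ≡ 0ℚ)
  closed-zero i = record
    { scale-closed = λ c r _ e → trans (cong (c *_) e) (*-zeroʳ c)
    ; add-closed   = λ r s e e' → trans (cong₂ _+_ e e') (+-identityʳ 0ℚ) }

  dot-add : ∀ r s x → dot (a (add r s)) x ≡ dot (a r) x + dot (a s) x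
  dot-add r s x = trans (sumFin-cong K (λ i → *-distribʳ-+ (x i) (a r i) (a s i))) (sumFin-+ K _ _)

  dot-scale : ∀ c r x → dot (a (scale c r)) x ≡ c * dot (a r) x
  dot-scale c r x = trans (sumFin-cong K (λ i → *-assoc c (a r i) (x i))) (sumFin-* K c _)

  sat-unscale : ∀ x c r → 0ℚ < c → Sat x (scale c r) → Sat x r
  sat-unscale x c r hc s =
    *-cancelˡ-≤-pos c {{positive hc}} (subst (_≤ c * b r) (dot-scale c r x) s)

  module Sort (j : Fin K) where

    Zs Ps Ns : List Row → List Row
    Zs []       = []
    Zs (r ∷ rs) with <-cmp (a r j) 0ℚ
    ... | tri≈ _ _ _ = r ∷ Zs rs
    ... | tri< _ _ _ = Zs rs
    ... | tri> _ _ _ = Zs rs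
    Ps []       = []
    Ps (r ∷ rs) with <-cmp (a r j) 0ℚ
    ... | tri> _ _ h = scale (recip (a r j) h) r ∷ Ps rs
    ... | tri≈ _ _ _ = Ps rs
    ... | tri< _ _ _ = Ps rs
    Ns []       = []
    Ns (r ∷ rs) with <-cmp (a r j) 0ℚ
    ... | tri< h _ _ = scale (recip (- a r j) (neg-antimono-< h)) r ∷ Ns rs
    ... | tri≈ _ _ _ = Ns rs
    ... | tri> _ _ _ = Ns rs

    sorted : ∀ {Q} → Closed Q → ∀ {rs} → All Q rs →
      All (λ r → Q r × a r j ≡ 0ℚ) (Zs rs) × All (λ r → Q r × a r j ≡ 1ℚ) (Ps rs) ×
      All (λ r → Q r × a r j ≡ - 1ℚ) (Ns rs)
    sorted cQ {[]} [] = [] , [] , []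
    sorted cQ {r ∷ rs} (q ∷ qs) with <-cmp (a r j) 0ℚ | sorted cQ qs
    ... | tri≈ _ e _ | zs , ps , ns = (q , e) ∷ zs , ps , ns
    ... | tri> _ _ h | zs , ps , ns =
      zs , (scale-closed cQ _ r (recip-pos _ h) q , recip-* (a r j) h) ∷ ps , ns
    ... | tri< h _ _ | zs , ps , ns =
      zs , ps , (scale-closed cQ _ r (recip-pos _ h') q , coeff) ∷ ns
      where
      h' = neg-antimono-< h
      coeff : recip (- a r j) h' * a r j ≡ - 1ℚ
      coeff = trans (solve 2 (λ c x → c :* x := :- (c :* (:- x))) refl (recip (- a r j) h') (a r j))
                    (cong -_ (recip-* (- a r j) h'))

    unsort : ∀ x rs → All (Sat x) (Zs rs) → All (Sat x) (Ps rs) → All (Sat x) (Ns rs) →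
      All (Sat x) rs
    unsort x [] _ _ _ = []
    unsort x (r ∷ rs) z p n with <-cmp (a r j) 0ℚ
    unsort x (r ∷ rs) (z ∷ zs) p n | tri≈ _ _ _ = z ∷ unsort x rs zs p n
    unsort x (r ∷ rs) z (p ∷ ps) n | tri> _ _ h =
      sat-unscale x _ r (recip-pos _ h) p ∷ unsort x rs z ps n
    unsort x (r ∷ rs) z p (n ∷ ns) | tri< h _ _ =
      sat-unscale x _ r (recip-pos _ (neg-antimono-< h)) n ∷ unsort x rs z p ns

  combos : List Row → List Row → List Row
  combos []      N = []
  combos (p ∷ P) N = map (add p) N ++ combos P N

  combos-all : ∀ {R S T : Row → Set} → (∀ {p n} → R p → S n → T (add p n)) →
    ∀ {P N} → All R P → All S N → All T (combos P N)
  combos-all f []        sN = []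
  combos-all f (rp ∷ rP) sN = AllP.++⁺ (AllP.map⁺ (All.map (f rp) sN)) (combos-all f rP sN)

  combos-sat : ∀ x P N → All (Sat x) (combos P N) → All (λ p → All (λ n → Sat x (add p n)) N) P
  combos-sat x []      N _ = []
  combos-sat x (p ∷ P) N s with AllP.++⁻ (map (add p) N) s
  ... | sp , sP = AllP.map⁻ sp ∷ combos-sat x P N sP

  elim : Fin K → List Row → List Row
  elim j rs = Zs rs ++ combos (Ps rs) (Ns rs) where open Sort j

  elim-spec : ∀ {Q} → Closed Q → ∀ j {rs} → All Q rs → All (λ r → Q r × a r j ≡ 0ℚ) (elim j rs)
  elim-spec {Q} cQ j qs with Sort.sorted j cQ qs
  ... | zs , ps , ns = AllP.++⁺ zs (combos-all cancel ps ns)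
    where
    cancel : ∀ {p n} → Q p × a p j ≡ 1ℚ → Q n × a n j ≡ - 1ℚ → Q (add p n) × a (add p n) j ≡ 0ℚ
    cancel {p} {n} (qp , ep) (qn , en) =
      add-closed cQ p n qp qn , trans (cong₂ _+_ ep en) (+-inverseʳ 1ℚ)

  upd : (Fin K → ℚ) → Fin K → ℚ → Fin K → ℚ
  upd x j v i = x i + unit j i * (v - x j)

  upd-other : ∀ x j v i → ¬ i ≡ j → upd x j v i ≡ x i
  upd-other x j v i i≢j =
    trans (cong (λ u → x i + u * (v - x j)) (unit-other j i i≢j))
          (solve 2 (λ y d → y :+ con 0ℚ :* d := y) refl (x i) (v - x j))

  upd-term : ∀ (c x u d : ℚ) → c * (x + u * d) ≡ c * x + u * (c * d)
  upd-term = solve 4 (λ c x u d → c :* (x :+ u :* d) := c :* x :+ u :* (c :* d)) refl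

  dot-upd : ∀ c x j v → dot c (upd x j v) ≡ dot c x + c j * (v - x j)
  dot-upd c x j v =
    trans (sumFin-cong K (λ i → upd-term (c i) (x i) (unit j i) (v - x j)))
          (trans (sumFin-+ K (λ i → c i * x i) (λ i → unit j i * (c i * (v - x j))))
                 (cong (dot c x +_) (sumFin-unit K j (λ i → c i * (v - x j)))))

  module Extend (x : Fin K → ℚ) (j : Fin K) where
    open Sort j

    -- the bound on the new value of x j imposed by a row with coefficient -1 resp. +1 at j
    lower upper : Row → ℚ
    lower n = dot (a n) x + x j - b n
    upper p = b p - dot (a p) x + x j

    lower≤upper : ∀ p n → Sat x (add p n) → lower n ≤ upper p
    lower≤upper p n s = subst₂ _≤_ e₁ e₂ (+-monoˡ-≤ (x j - b n - dot (a p) x) s')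
      where
      s' : dot (a p) x + dot (a n) x ≤ b p + b n
      s' = subst (_≤ b p + b n) (dot-add p n x) s
      e₁ : dot (a p) x + dot (a n) x + (x j - b n - dot (a p) x) ≡ lower n
      e₁ = solve 4 (λ dp dn xj bn → dp :+ dn :+ (xj :- bn :- dp) := dn :+ xj :- bn)
                   refl (dot (a p) x) (dot (a n) x) (x j) (b n)
      e₂ : b p + b n + (x j - b n - dot (a p) x) ≡ upper p
      e₂ = solve 4 (λ bp bn xj dp → bp :+ bn :+ (xj :- bn :- dp) := bp :- dp :+ xj)
                   refl (b p) (b n) (x j) (dot (a p) x)

    sat-zero : ∀ v r → a r j ≡ 0ℚ → Sat x r → Sat (upd x j v) r
    sat-zero v r e s = subst (_≤ b r) (sym eq) s
      where
      eq : dot (a r) (upd x j v) ≡ dot (a r) x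
      eq = trans (dot-upd (a r) x j v) (trans (cong (λ c → dot (a r) x + c * (v - x j)) e)
             (solve 2 (λ d w → d :+ con 0ℚ :* w := d) refl (dot (a r) x) (v - x j)))

    sat-upper : ∀ v p → a p j ≡ 1ℚ → v ≤ upper p → Sat (upd x j v) p
    sat-upper v p e h = subst₂ _≤_ (sym eq) e₂ (+-monoˡ-≤ (dot (a p) x - x j) h)
      where
      eq : dot (a p) (upd x j v) ≡ v + (dot (a p) x - x j)
      eq = trans (dot-upd (a p) x j v) (trans (cong (λ c → dot (a p) x + c * (v - x j)) e)
             (solve 3 (λ d v xj → d :+ con 1ℚ :* (v :- xj) := v :+ (d :- xj)) refl (dot (a p) x) v (x j)))
      e₂ : upper p + (dot (a p) x - x j) ≡ b p
      e₂ = solve 3 (λ bp d xj → bp :- d :+ xj :+ (d :- xj) := bp) refl (b p) (dot (a p) x) (x j)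

    sat-lower : ∀ v n → a n j ≡ - 1ℚ → lower n ≤ v → Sat (upd x j v) n
    sat-lower v n e h = subst₂ _≤_ (sym eq) e₂ (+-monoˡ-≤ (b n - v) h)
      where
      eq : dot (a n) (upd x j v) ≡ lower n + (b n - v)
      eq = trans (dot-upd (a n) x j v) (trans (cong (λ c → dot (a n) x + c * (v - x j)) e)
             (solve 4 (λ d v xj bn → d :+ (:- con 1ℚ) :* (v :- xj) := d :+ xj :- bn :+ (bn :- v))
                      refl (dot (a n) x) v (x j) (b n)))
      e₂ : v + (b n - v) ≡ b n
      e₂ = solve 2 (λ v bn → v :+ (bn :- v) := bn) refl v (b n)

    -- The (+1)-rows and (-1)-rows bound x j from above and below; the combined rows say that all
    -- lower bounds lie below all upper bounds, so a value in between satisfies every row.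
    extend : ∀ rs → All (Sat x) (elim j rs) → Σ ℚ λ v → All (Sat (upd x j v)) rs
    extend rs s = v , unsort (upd x j v) rs sat-Zs sat-Ps sat-Ns
      where
      classes = sorted closed-⊤ (All.universal (λ _ → tt) rs)
      bounds : All (λ p → All (_≤ upper p) (map lower (Ns rs))) (Ps rs)
      bounds = All.map (λ {p} h → AllP.map⁺ (All.map (λ {n} → lower≤upper p n) h))
                       (combos-sat x (Ps rs) (Ns rs) (AllP.++⁻ʳ (Zs rs) s))
      choice = between (map lower (Ns rs)) (map upper (Ps rs)) (AllP.map⁺ bounds)
      v : ℚ
      v = proj₁ choice
      sat-Zs : All (Sat (upd x j v)) (Zs rs)
      sat-Zs = All.zipWith (λ {r} ((_ , e) , s) → sat-zero v r e s)
                           (proj₁ classes , AllP.++⁻ˡ (Zs rs) s)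
      sat-Ps : All (Sat (upd x j v)) (Ps rs)
      sat-Ps = All.zipWith (λ {p} ((_ , e) , h) → sat-upper v p e h)
                           (proj₁ (proj₂ classes) , AllP.map⁻ (proj₂ (proj₂ choice)))
      sat-Ns : All (Sat (upd x j v)) (Ns rs)
      sat-Ns = All.zipWith (λ {n} ((_ , e) , h) → sat-lower v n e h)
                           (proj₂ (proj₂ classes) , AllP.map⁻ (proj₁ (proj₂ choice)))

  elimAll : List (Fin K) → List Row → List Row
  elimAll []       rs = rs
  elimAll (j ∷ js) rs = elimAll js (elim j rs)

  elimAll-spec : ∀ {Q} → Closed Q → ∀ js {rs} → All Q rs →
    All (λ r → Q r × All (λ i → a r i ≡ 0ℚ) js) (elimAll js rs)
  elimAll-spec cQ []       qs = All.map (λ q → q , []) qs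
  elimAll-spec cQ (j ∷ js) qs =
    All.map (λ ((q , e) , es) → q , e ∷ es)
            (elimAll-spec (closed-× cQ (closed-zero j)) js (elim-spec cQ j qs))

  elimAll-extend : ∀ i₀ js rs → All (λ j → ¬ i₀ ≡ j) js → ∀ x → All (Sat x) (elimAll js rs) →
    Σ (Fin K → ℚ) λ x' → All (Sat x') rs × x' i₀ ≡ x i₀
  elimAll-extend i₀ []       rs _ x s = x , s , refl
  elimAll-extend i₀ (j ∷ js) rs (i₀≢j ∷ i₀∉js) x s = upd x₁ j v , sat , trans (upd-other x₁ j v i₀ i₀≢j) x₁≡x
    where
    previous = elimAll-extend i₀ js (elim j rs) i₀∉js x s
    x₁ : Fin K → ℚ
    x₁ = proj₁ previous
    x₁≡x : x₁ i₀ ≡ x i₀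
    x₁≡x = proj₂ (proj₂ previous)
    step = Extend.extend x₁ j rs (proj₁ (proj₂ previous))
    v : ℚ
    v = proj₁ step
    sat : All (Sat (upd x₁ j v)) rs
    sat = proj₂ step

weightOn : ∀ {n} → Subset n → (Fin n → ℚ) → ℚ
weightOn {n} e t = sumFin n (λ w → ind (lookup e w) (t w))

IsFracCover : ∀ {n} → Hypergraph n → (Fin n → ℚ) → Set
IsFracCover {n} H t = (∀ w → 0ℚ ≤ t w) × (∀ e → e ∈ᴸ H → 1ℚ ≤ weightOn e t)

module _ {n} (H : Hypergraph n) where

  load-scale : ∀ c (μ : Weighting H) w → load H (λ i → c * μ i) w ≡ c * load H μ w
  load-scale c μ w =
    trans (sumFin-cong (length H) (λ i → ind-* (lookup (List.lookup H i) w) c (μ i))) (sumFin-* (length H) c _)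

  load-add : ∀ (μ ν : Weighting H) w → load H (λ i → μ i + ν i) w ≡ load H μ w + load H ν w
  load-add μ ν w =
    trans (sumFin-cong (length H) (λ i → ind-+ (lookup (List.lookup H i) w) (μ i) (ν i))) (sumFin-+ (length H) _ _)

  load-zero : ∀ w → load H (λ _ → 0ℚ) w ≡ 0ℚ
  load-zero w = trans (sumFin-cong (length H) (λ i → ind-0 (lookup (List.lookup H i) w))) (sumFin-0 (length H))

  zeroMatching : IsFracMatching H (λ _ → 0ℚ)
  zeroMatching = (λ _ → ≤-refl) , (λ w → subst (_≤ 1ℚ) (sym (load-zero w)) 0≤1)

  weight≤load : ∀ (μ : Weighting H) → (∀ i → 0ℚ ≤ μ i) → ∀ i w →
    lookup (List.lookup H i) w ≡ true → μ i ≤ load H μ w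
  weight≤load μ μ≥0 i w w∈e =
    subst (_≤ load H μ w) (cong (λ b → ind b (μ i)) w∈e)
          (sumFin-term (length H) (λ k → ind-nonneg (lookup (List.lookup H k) w) (μ≥0 k)) i)

-- Weak duality: a fractional matching weighs at most as much as a fractional cover, since
--   Σ_e g e ≤ Σ_e g e · t(e) = Σ_v t v · load g v ≤ Σ_v t v.
weakDuality : ∀ {n} (H : Hypergraph n) (g : Weighting H) (t : Fin n → ℚ) →
  IsFracMatching H g → IsFracCover H t → total H g ≤ sumFin n t
weakDuality {n} H g t (g≥0 , g-load) (t≥0 , t-cover) = begin
  sumFin m g
    ≤⟨ sumFin-mono m (λ i → subst (_≤ g i * weightOn (E i) t) (*-identityʳ (g i))
                                 (*-monoˡ-≤-≥0 (g≥0 i) (t-cover (E i) (∈-lookup i)))) ⟩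
  sumFin m (λ i → g i * weightOn (E i) t)
    ≡⟨ sumFin-cong m (λ i → sym (sumFin-* n (g i) _)) ⟩
  sumFin m (λ i → sumFin n (λ w → g i * ind (lookup (E i) w) (t w)))
    ≡⟨ sumFin-cong m (λ i → sumFin-cong n (λ w → swap-ind (lookup (E i) w) (g i) (t w))) ⟩
  sumFin m (λ i → sumFin n (λ w → t w * ind (lookup (E i) w) (g i)))
    ≡⟨ sumFin-swap m n _ ⟩
  sumFin n (λ w → sumFin m (λ i → t w * ind (lookup (E i) w) (g i)))
    ≡⟨ sumFin-cong n (λ w → sumFin-* m (t w) _) ⟩
  sumFin n (λ w → t w * load H g w)
    ≤⟨ sumFin-mono n (λ w → subst (t w * load H g w ≤_) (*-identityʳ (t w))
                                  (*-monoˡ-≤-≥0 (t≥0 w) (g-load w))) ⟩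
  sumFin n t ∎
  where
  open ≤-Reasoning
  m = length H
  E = List.lookup H
  swap-ind : ∀ b x y → x * ind b y ≡ y * ind b x
  swap-ind true  x y = *-comm x y
  swap-ind false x y = trans (*-zeroʳ x) (sym (*-zeroʳ y))

-- Apply Fourier–Motzkin to the system
--     -t w ≤ 0,     -Σ_{w∈e} t w ≤ -1  (e ∈ H),     -z + Σ_w t w ≤ 0
-- in the variables z, t.  Every derived row is certified by dual multipliers (κ on the last row,
-- μ on the edge rows); once t is eliminated, each row only says  κ·z ≥ Σ μ, where μ/κ is a
-- fractional matching.  Taking z to be the total of the heaviest of these matchings and extending
-- back to t gives a cover t with Σ t ≤ z.
module Duality {n} (H : Hypergraph n)
  (nonempty : ∀ e → e ∈ᴸ H → Σ (Fin n) λ w → lookup e w ≡ true) where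

  open FourierMotzkin (suc n)

  m : ℕ
  m = length H

  E : Fin m → Subset n
  E = List.lookup H

  -- coordinate fz is z, coordinate fs w is t w
  nonnegRow : Fin n → Row
  nonnegRow u = row (λ i → - unit (fs u) i) 0ℚ

  edgeCoeff : Fin m → Fin (suc n) → ℚ
  edgeCoeff i fz     = 0ℚ
  edgeCoeff i (fs w) = - ind (lookup (E i) w) 1ℚ

  edgeRow : Fin m → Row
  edgeRow i = row (edgeCoeff i) (- 1ℚ)

  objectiveCoeff : Fin (suc n) → ℚ
  objectiveCoeff fz     = - 1ℚ
  objectiveCoeff (fs w) = 1ℚ

  objectiveRow : Row
  objectiveRow = row objectiveCoeff 0ℚ

  rows : List Row
  rows = tabulate nonnegRow ++ tabulate edgeRow ++ objectiveRow ∷ []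

  -- A row certified as a nonnegative combination of the rows above, recording the multipliers
  -- κ of the objective row and μ of the edge rows (the nonnegativity rows only lower the t-part).
  record Certificate (r : Row) : Set where
    field
      μ       : Weighting H
      κ       : ℚ
      μ≥0     : ∀ i → 0ℚ ≤ μ i
      κ≥0     : 0ℚ ≤ κ
      coeff-z : a r fz ≡ - κ
      bound   : b r ≡ - total H μ
      coeff-t : ∀ w → a r (fs w) + load H μ w ≤ κ
  open Certificate

  certified : Closed Certificate
  certified = record { scale-closed = scaled ; add-closed = added }
    where
    scaled : ∀ c r → 0ℚ < c → Certificate r → Certificate (scale c r)
    scaled c r hc C = record
      { μ       = λ i → c * μ C i
      ; κ       = c * κ C
      ; μ≥0     = λ i → *-nonneg (<⇒≤ hc) (μ≥0 C i)
      ; κ≥0     = *-nonneg (<⇒≤ hc) (κ≥0 C)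
      ; coeff-z = trans (cong (c *_) (coeff-z C)) (sym (neg-distribʳ-* c (κ C)))
      ; bound   = trans (cong (c *_) (bound C))
                        (trans (sym (neg-distribʳ-* c (total H (μ C)))) (cong -_ (sym (sumFin-* m c (μ C)))))
      ; coeff-t = λ w → subst (_≤ c * κ C)
                   (trans (*-distribˡ-+ c (a r (fs w)) (load H (μ C) w))
                          (cong (c * a r (fs w) +_) (sym (load-scale H c (μ C) w))))
                   (*-monoˡ-≤-≥0 (<⇒≤ hc) (coeff-t C w))
      }
    added : ∀ r s → Certificate r → Certificate s → Certificate (add r s)
    added r s C D = record
      { μ       = λ i → μ C i + μ D i
      ; κ       = κ C + κ D
      ; μ≥0     = λ i → +-mono-≤ (μ≥0 C i) (μ≥0 D i)
      ; κ≥0     = +-mono-≤ (κ≥0 C) (κ≥0 D)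
      ; coeff-z = trans (cong₂ _+_ (coeff-z C) (coeff-z D)) (sym (neg-distrib-+ (κ C) (κ D)))
      ; bound   = trans (cong₂ _+_ (bound C) (bound D))
                        (trans (sym (neg-distrib-+ (total H (μ C)) (total H (μ D))))
                               (cong -_ (sym (sumFin-+ m (μ C) (μ D)))))
      ; coeff-t = λ w → subst (_≤ κ C + κ D)
                   (trans (solve 4 (λ a l a' l' → (a :+ l) :+ (a' :+ l') := (a :+ a') :+ (l :+ l'))
                                   refl (a r (fs w)) (load H (μ C) w) (a s (fs w)) (load H (μ D) w))
                          (cong (a r (fs w) + a s (fs w) +_) (sym (load-add H (μ C) (μ D) w))))
                   (+-mono-≤ (coeff-t C w) (coeff-t D w))
      }

  load-unit : ∀ i w → load H (unit i) w ≡ ind (lookup (E i) w) 1ℚ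
  load-unit i w =
    trans (sumFin-point m _ i (λ k k≢i → trans (cong (ind (lookup (E k) w)) (unit-other i k k≢i))
                                                (ind-0 (lookup (E k) w))))
          (cong (ind (lookup (E i) w)) (unit-self i))

  nonnegCertificate : ∀ u → Certificate (nonnegRow u)
  nonnegCertificate u = record
    { μ = λ _ → 0ℚ ; κ = 0ℚ ; μ≥0 = λ _ → ≤-refl ; κ≥0 = ≤-refl
    ; coeff-z = cong -_ (unit-other (fs u) fz (λ ()))
    ; bound   = cong -_ (sym (sumFin-0 m))
    ; coeff-t = λ w → subst (_≤ 0ℚ) (sym (trans (cong (- unit (fs u) (fs w) +_) (load-zero H w)) (+-identityʳ _)))
                            (neg-antimono-≤ (unit-nonneg (fs u) (fs w)))
    }

  edgeCertificate : ∀ i → Certificate (edgeRow i)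
  edgeCertificate i = record
    { μ = unit i ; κ = 0ℚ ; μ≥0 = unit-nonneg i ; κ≥0 = ≤-refl
    ; coeff-z = refl
    ; bound   = cong -_ (sym (trans (sumFin-cong m (λ k → sym (*-identityʳ (unit i k))))
                                    (sumFin-unit m i (λ _ → 1ℚ))))
    ; coeff-t = λ w → ≤-reflexive (trans (cong (- ind (lookup (E i) w) 1ℚ +_) (load-unit i w))
                                         (+-inverseˡ (ind (lookup (E i) w) 1ℚ)))
    }

  objectiveCertificate : Certificate objectiveRow
  objectiveCertificate = record
    { μ = λ _ → 0ℚ ; κ = 1ℚ ; μ≥0 = λ _ → ≤-refl ; κ≥0 = 0≤1
    ; coeff-z = refl
    ; bound   = cong -_ (sym (sumFin-0 m))
    ; coeff-t = λ w → ≤-reflexive (trans (cong (1ℚ +_) (load-zero H w)) (+-identityʳ 1ℚ))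
    }

  rows-certified : All Certificate rows
  rows-certified = AllP.++⁺ (AllP.tabulate⁺ nonnegCertificate)
                            (AllP.++⁺ (AllP.tabulate⁺ edgeCertificate) (objectiveCertificate ∷ []))

  atZ : ℚ → Fin (suc n) → ℚ
  atZ z fz     = z
  atZ z (fs _) = 0ℚ

  dot-atZ : ∀ r z → dot (a r) (atZ z) ≡ a r fz * z
  dot-atZ r z = trans (cong (a r fz * z +_) (trans (sumFin-cong n (λ w → *-zeroʳ (a r (fs w))))
                                                 (sumFin-0 n)))
                      (+-identityʳ _)

  Bounded : Weighting H → Row → Set
  Bounded μ r = ∀ z → total H μ ≤ z → Sat (atZ z) r

  -- A certified row without t-part is implied by some fractional matching: μ/κ if κ > 0, and the
  -- zero matching if κ = 0 (then μ has no load anywhere, so its total is not positive).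
  reducedRowBound : ∀ r → Certificate r → (∀ w → a r (fs w) ≡ 0ℚ) →
    Σ (Weighting H) λ μ' → IsFracMatching H μ' × Bounded μ' r
  reducedRowBound r C t-free with <-cmp 0ℚ (κ C)
  ... | tri> _ _ κ<0 = ⊥-elim (<-irrefl refl (≤-<-trans (κ≥0 C) κ<0))
  ... | tri≈ _ κ≡0 _ = (λ _ → 0ℚ) , zeroMatching H , λ z _ → subst₂ _≤_ (sym dot≡0) (sym (bound C)) (neg-antimono-≤ total≤0)
    where
    load≤0 : ∀ w → load H (μ C) w ≤ 0ℚ
    load≤0 w = subst₂ _≤_ (trans (cong (_+ load H (μ C) w) (t-free w)) (+-identityˡ _)) (sym κ≡0) (coeff-t C w)
    total≤0 : total H (μ C) ≤ 0ℚ
    total≤0 = subst (total H (μ C) ≤_) (sumFin-0 m) (sumFin-mono m (λ i →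
      let (w , w∈e) = nonempty (E i) (∈-lookup i)
      in ≤-trans (weight≤load H (μ C) (μ≥0 C) i w w∈e) (load≤0 w)))
    dot≡0 : ∀ {z} → dot (a r) (atZ z) ≡ - 0ℚ
    dot≡0 {z} = trans (dot-atZ r z) (trans (cong (_* z) (trans (coeff-z C) (cong -_ (sym κ≡0)))) (*-zeroˡ z))
  ... | tri< κ>0 _ _ = (λ i → c * μ C i) , matching , bounded
    where
    c = recip (κ C) κ>0
    c≥0 : 0ℚ ≤ c
    c≥0 = <⇒≤ (recip-pos (κ C) κ>0)
    matching : IsFracMatching H (λ i → c * μ C i)
    matching = (λ i → *-nonneg c≥0 (μ≥0 C i)) , λ w →
      subst₂ _≤_ (sym (load-scale H c (μ C) w)) (recip-* (κ C) κ>0)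
        (*-monoˡ-≤-≥0 c≥0 (subst (_≤ κ C) (trans (cong (_+ load H (μ C) w) (t-free w)) (+-identityˡ _))
                                  (coeff-t C w)))
    bounded : Bounded (λ i → c * μ C i) r
    bounded z h = subst₂ _≤_ (sym dot≡) (sym (bound C)) (neg-antimono-≤ total≤κz)
      where
      W = total H (μ C)
      κcW≡W : κ C * (c * W) ≡ W
      κcW≡W = trans (solve 3 (λ k i t → k :* (i :* t) := (i :* k) :* t) refl (κ C) c W)
                    (trans (cong (_* W) (recip-* (κ C) κ>0)) (*-identityˡ W))
      total≤κz : W ≤ κ C * z
      total≤κz = subst (_≤ κ C * z) κcW≡W
                       (*-monoˡ-≤-≥0 (κ≥0 C) (subst (_≤ z) (sumFin-* m c (μ C)) h))
      dot≡ : dot (a r) (atZ z) ≡ - (κ C * z)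
      dot≡ = trans (dot-atZ r z) (trans (cong (_* z) (coeff-z C)) (sym (neg-distribˡ-* (κ C) z)))

  heaviest : ∀ F → All (λ r → Certificate r × (∀ w → a r (fs w) ≡ 0ℚ)) F →
    Σ (Weighting H) λ μ* → IsFracMatching H μ* × All (Bounded μ*) F
  heaviest [] [] = (λ _ → 0ℚ) , zeroMatching H , []
  heaviest (r ∷ F) ((C , t-free) ∷ cs)
    with reducedRowBound r C t-free | heaviest F cs
  ... | μ' , M' , b' | μ* , M* , bs with ≤-total (total H μ') (total H μ*)
  ...   | inj₁ μ'≤μ* = μ* , M* , (λ z h → b' z (≤-trans μ'≤μ* h)) ∷ bs
  ...   | inj₂ μ*≤μ' = μ' , M' , b' ∷ All.map (λ b z h → b z (≤-trans μ*≤μ' h)) bs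

  dot-nonnegRow : ∀ u x → dot (a (nonnegRow u)) x ≡ - x (fs u)
  dot-nonnegRow u x =
    trans (sumFin-cong (suc n) (λ i → sym (neg-distribˡ-* (unit (fs u) i) (x i))))
          (trans (sumFin-neg (suc n) (λ i → unit (fs u) i * x i)) (cong -_ (sumFin-unit (suc n) (fs u) x)))

  dot-edgeRow : ∀ i x → dot (a (edgeRow i)) x ≡ - weightOn (E i) (x ∘ fs)
  dot-edgeRow i x =
    trans (cong (_+ sumFin n (λ w → edgeCoeff i (fs w) * x (fs w))) (*-zeroˡ (x fz)))
          (trans (+-identityˡ _)
                 (trans (sumFin-cong n (λ w → neg-ind (lookup (E i) w) (x (fs w))))
                        (sumFin-neg n (λ w → ind (lookup (E i) w) (x (fs w))))))
    where
    neg-ind : ∀ b y → - ind b 1ℚ * y ≡ - ind b y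
    neg-ind true  y = solve 1 (λ y → (:- con 1ℚ) :* y := :- y) refl y
    neg-ind false y = *-zeroˡ y

  dot-objectiveRow : ∀ x → dot (a objectiveRow) x ≡ - 1ℚ * x fz + sumFin n (x ∘ fs)
  dot-objectiveRow x = cong (- 1ℚ * x fz +_) (sumFin-cong n (λ w → *-identityˡ (x (fs w))))

  solutionCover : ∀ x → All (Sat x) rows → IsFracCover H (x ∘ fs) × sumFin n (x ∘ fs) ≤ x fz
  solutionCover x sat-rows = (t≥0 , t-cover) , t≤z
    where
    t : Fin n → ℚ
    t = x ∘ fs
    sat-rest = AllP.++⁻ʳ (tabulate nonnegRow) sat-rows
    t≥0 : ∀ w → 0ℚ ≤ t w
    t≥0 w = neg-cancel-≤ (subst (_≤ 0ℚ) (dot-nonnegRow w x)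
                                (AllP.tabulate⁻ (AllP.++⁻ˡ (tabulate nonnegRow) sat-rows) w))
    cover-edge : ∀ i → 1ℚ ≤ weightOn (E i) t
    cover-edge i = neg-cancel-≤ (subst (_≤ - 1ℚ) (dot-edgeRow i x)
                                       (AllP.tabulate⁻ (AllP.++⁻ˡ (tabulate edgeRow) sat-rest) i))
    t-cover : ∀ e → e ∈ᴸ H → 1ℚ ≤ weightOn e t
    t-cover e e∈H = subst (λ e' → 1ℚ ≤ weightOn e' t) (sym (lookup-index e∈H)) (cover-edge (index e∈H))
    t≤z : sumFin n t ≤ x fz
    t≤z = subst₂ _≤_ (solve 2 (λ z s → (:- con 1ℚ) :* z :+ s :+ z := s) refl (x fz) (sumFin n t))
                     (+-identityˡ (x fz))
                     (+-monoˡ-≤ (x fz) (subst (_≤ 0ℚ) (dot-objectiveRow x)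
                                               (All.head (AllP.++⁻ʳ (tabulate edgeRow) sat-rest))))

  strongDuality : Σ (Fin n → ℚ) λ t → Σ (Weighting H) λ μ →
    IsFracMatching H μ × IsFracCover H t × sumFin n t ≤ total H μ
  strongDuality = x ∘ fs , μ* , matching , proj₁ cover , subst (sumFin n (x ∘ fs) ≤_) x-z (proj₂ cover)
    where
    tVariables : List (Fin (suc n))
    tVariables = tabulate fs
    reduced = elimAll-spec certified tVariables rows-certified
    best = heaviest (elimAll tVariables rows) (All.map (λ (C , zs) → C , AllP.tabulate⁻ zs) reduced)
    μ* : Weighting H
    μ* = proj₁ best
    matching : IsFracMatching H μ*
    matching = proj₁ (proj₂ best)
    solution = elimAll-extend fz tVariables rows (AllP.tabulate⁺ (λ _ ())) (atZ (total H μ*))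
                              (All.map (λ b → b (total H μ*) ≤-refl) (proj₂ (proj₂ best)))
    x : Fin (suc n) → ℚ
    x = proj₁ solution
    x-z : x fz ≡ total H μ*
    x-z = proj₂ (proj₂ solution)
    cover = solutionCover x (proj₁ (proj₂ solution))

false≢true : ¬ false ≡ true
false≢true ()

minimumOn : ∀ k (f : Fin k → ℚ) (p : Fin k → Bool) →
  (∀ w → p w ≡ false) ⊎ Σ (Fin k) λ u → p u ≡ true × (∀ w → p w ≡ true → f u ≤ f w)
minimumOn zero    f p = inj₁ (λ ())
minimumOn (suc k) f p with p fz in p0 | minimumOn k (f ∘ fs) (p ∘ fs)
... | false | inj₁ none = inj₁ λ { fz → p0 ; (fs w) → none w }
... | false | inj₂ (u , pu , min) =
  inj₂ (fs u , pu , λ { fz pw → ⊥-elim (false≢true (trans (sym p0) pw)) ; (fs w) pw → min w pw })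
... | true | inj₁ none =
  inj₂ (fz , p0 , λ { fz _ → ≤-refl ; (fs w) pw → ⊥-elim (false≢true (trans (sym (none w)) pw)) })
... | true | inj₂ (u , pu , min) with ≤-total (f fz) (f (fs u))
...   | inj₁ f0≤fu = inj₂ (fz , p0 , λ { fz _ → ≤-refl ; (fs w) pw → ≤-trans f0≤fu (min w pw) })
...   | inj₂ fu≤f0 = inj₂ (fs u , pu , λ { fz _ → fu≤f0 ; (fs w) pw → min w pw })

argminOn : ∀ k (f : Fin k → ℚ) (p : Fin k → Bool) → Σ (Fin k) (λ w → p w ≡ true) →
  Σ (Fin k) λ u → p u ≡ true × (∀ w → p w ≡ true → f u ≤ f w)
argminOn k f p (w₀ , pw₀) with minimumOn k f p
... | inj₁ none    = ⊥-elim (false≢true (trans (sym (none w₀)) pw₀))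
... | inj₂ minimum = minimum

χ : ∀ {n} → (Fin n → Bool) → Fin n → ℚ
χ A w = ind (A w) 1ℚ

χ-nonneg : ∀ {n} (A : Fin n → Bool) w → 0ℚ ≤ χ A w
χ-nonneg A w = ind-nonneg (A w) 0≤1

sumFin-shift : ∀ k (f g h : Fin k → ℚ) c →
  sumFin k (λ w → f w - c * g w + c * h w) ≡ sumFin k f - c * sumFin k g + c * sumFin k h
sumFin-shift k f g h c =
  trans (sumFin-+ k (λ w → f w - c * g w) (λ w → c * h w))
        (cong₂ _+_ (trans (sumFin-+ k f (λ w → - (c * g w)))
                          (cong (sumFin k f +_) (trans (sumFin-neg k (λ w → c * g w))
                                                       (cong -_ (sumFin-* k c g)))))
                   (sumFin-* k c h))

weightOn-shift : ∀ {n} (e : Subset n) (f g h : Fin n → ℚ) c →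
  weightOn e (λ w → f w - c * g w + c * h w) ≡ weightOn e f - c * weightOn e g + c * weightOn e h
weightOn-shift {n} e f g h c =
  trans (sumFin-cong n (λ w → ind-shift (lookup e w) (f w) (g w) (h w)))
        (sumFin-shift n (λ w → ind (lookup e w) (f w)) (λ w → ind (lookup e w) (g w))
                        (λ w → ind (lookup e w) (h w)) c)
  where
  ind-shift : ∀ b x y z → ind b (x - c * y + c * z) ≡ ind b x - c * ind b y + c * ind b z
  ind-shift true  x y z = refl
  ind-shift false x y z = solve 1 (λ c → con 0ℚ := con 0ℚ :- c :* con 0ℚ :+ c :* con 0ℚ) refl c

module Shift {n} (H : Hypergraph n) (A B : Fin n → Bool)
  (A-once : ∀ e → e ∈ᴸ H → weightOn e (χ A) ≡ 1ℚ) (B-once : ∀ e → e ∈ᴸ H → weightOn e (χ B) ≡ 1ℚ)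
  (disjoint : ∀ w → A w ≡ true → B w ≡ false) (|B|≤|A| : sumFin n (χ B) ≤ sumFin n (χ A))
  (t : Fin n → ℚ) (t-cover : IsFracCover H t)
  (u : Fin n) (u∈A : A u ≡ true) (u-min : ∀ w → A w ≡ true → t u ≤ t w) where

  α : ℚ
  α = t u

  α≥0 : 0ℚ ≤ α
  α≥0 = proj₁ t-cover u

  shifted : Fin n → ℚ
  shifted w = t w - α * χ A w + α * χ B w

  shifted-nonneg : ∀ w → 0ℚ ≤ shifted w
  shifted-nonneg w = subst (_≤ shifted w) (+-identityˡ 0ℚ)
                           (+-mono-≤ (removed≥0 w) (*-nonneg α≥0 (χ-nonneg B w)))
    where
    removed≥0 : ∀ w → 0ℚ ≤ t w - α * χ A w
    removed≥0 w with A w in w∈A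
    ... | true  = subst (λ q → 0ℚ ≤ t w - q) (sym (*-identityʳ α))
                        (subst (_≤ t w - α) (+-inverseʳ α) (+-monoˡ-≤ (- α) (u-min w w∈A)))
    ... | false = subst (0ℚ ≤_) (solve 2 (λ x a → x := x :- a :* con 0ℚ) refl (t w) α) (proj₁ t-cover w)

  shifted-cover : IsFracCover H shifted
  shifted-cover = shifted-nonneg , λ e e∈H →
    subst (1ℚ ≤_) (sym (same-weight e e∈H)) (proj₂ t-cover e e∈H)
    where
    same-weight : ∀ e → e ∈ᴸ H → weightOn e shifted ≡ weightOn e t
    same-weight e e∈H =
      trans (weightOn-shift e t (χ A) (χ B) α)
            (trans (cong₂ (λ p q → weightOn e t - α * p + α * q) (A-once e e∈H) (B-once e e∈H))
                   (solve 2 (λ x a → x :- a :* con 1ℚ :+ a :* con 1ℚ := x) refl (weightOn e t) α))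

  shifted-u : shifted u ≡ 0ℚ
  shifted-u rewrite u∈A | disjoint u u∈A =
    solve 1 (λ a → a :- a :* con 1ℚ :+ a :* con 0ℚ := con 0ℚ) refl α

  shifted-sum : sumFin n shifted ≤ sumFin n t
  shifted-sum = subst (_≤ sumFin n t) (sym (sumFin-shift n t (χ A) (χ B) α))
    (subst (sumFin n t - α * sumFin n (χ A) + α * sumFin n (χ B) ≤_)
           (solve 2 (λ s c → s :- c :+ c := s) refl (sumFin n t) (α * sumFin n (χ A)))
           (+-monoʳ-≤ (sumFin n t - α * sumFin n (χ A)) (*-monoˡ-≤-≥0 α≥0 |B|≤|A|)))

  shiftedCover : Σ (Fin n → ℚ) λ t' → IsFracCover H t' × t' u ≡ 0ℚ × sumFin n t' ≤ sumFin n t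
  shiftedCover = shifted , shifted-cover , shifted-u , shifted-sum

offSet : ∀ {n} → Subset n → (Fin n → ℚ) → Fin n → ℚ
offSet S t w = if lookup S w then 0ℚ else t w

disjoint-lookup : ∀ {n} (e S : Subset n) w → T (disjointᵇ e S) → lookup e w ≡ true → lookup S w ≡ false
disjoint-lookup (true  ∷ e) (false ∷ S) fz     _ _ = refl
disjoint-lookup (false ∷ e) (_     ∷ S) fz     _ ()
disjoint-lookup (true  ∷ e) (true  ∷ S) _      () _
disjoint-lookup (false ∷ e) (_     ∷ S) (fs w) d h = disjoint-lookup e S w d h
disjoint-lookup (true  ∷ e) (false ∷ S) (fs w) d h = disjoint-lookup e S w d h

restrictCover : ∀ {n} (H : Hypergraph n) (S : Subset n) (t : Fin n → ℚ) →
  IsFracCover H t → IsFracCover (H -ᴴ S) (offSet S t)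
restrictCover {n} H S t (t≥0 , t-cover) = offSet≥0 , λ e e∈H-S →
  let (e∈H , e∩S=∅) = ∈-filter⁻ (λ e → T? (disjointᵇ e S)) {xs = H} e∈H-S
  in subst (1ℚ ≤_) (sumFin-cong n (λ w → unchanged e e∩S=∅ w)) (t-cover e e∈H)
  where
  offSet≥0 : ∀ w → 0ℚ ≤ offSet S t w
  offSet≥0 w with lookup S w
  ... | true  = ≤-refl
  ... | false = t≥0 w
  unchanged : ∀ e → T (disjointᵇ e S) → ∀ w → ind (lookup e w) (t w) ≡ ind (lookup e w) (offSet S t w)
  unchanged e e∩S=∅ w with lookup e w in w∈e
  ... | false = refl
  ... | true rewrite disjoint-lookup e S w e∩S=∅ w∈e = refl

sumFin-split : ∀ {n} (S : Subset n) (t : Fin n → ℚ) → sumFin n t ≡ sumFin n (offSet S t) + weightOn S t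
sumFin-split {n} S t = trans (sumFin-cong n pointwise) (sumFin-+ n (offSet S t) (λ w → ind (lookup S w) (t w)))
  where
  pointwise : ∀ w → t w ≡ offSet S t w + ind (lookup S w) (t w)
  pointwise w with lookup S w
  ... | true  = sym (+-identityˡ (t w))
  ... | false = sym (+-identityʳ (t w))

lookup-─-outside : ∀ {k} (p q : Subset k) w → lookup q w ≡ false → lookup (p ─ q) w ≡ lookup p w
lookup-─-outside (x ∷ p) (false ∷ q) fz     _ = refl
lookup-─-outside (x ∷ p) (y     ∷ q) (fs w) h = lookup-─-outside p q w h

lookup-⁅⁆-other : ∀ {k} {u w : Fin k} → ¬ w ≡ u → lookup ⁅ u ⁆ w ≡ false
lookup-⁅⁆-other {u = u} {w} w≢u with lookup ⁅ u ⁆ w in w∈u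
... | true  = ⊥-elim (x≢y⇒x∉⁅y⁆ w≢u (lookup⇒[]= w ⁅ u ⁆ w∈u))
... | false = refl

weightOn-remove : ∀ {n} (e : Subset n) (t : Fin n → ℚ) u → t u ≡ 0ℚ → weightOn (e ─ ⁅ u ⁆) t ≡ weightOn e t
weightOn-remove {n} e t u tu≡0 = sumFin-cong n pointwise
  where
  pointwise : ∀ w → ind (lookup (e ─ ⁅ u ⁆) w) (t w) ≡ ind (lookup e w) (t w)
  pointwise w with w ≟F u
  ... | yes refl = trans (cong (ind _) tu≡0) (trans (ind-0 _) (sym (trans (cong (ind _) tu≡0) (ind-0 _))))
  ... | no w≢u   = cong (λ b → ind b (t w)) (lookup-─-outside e ⁅ u ⁆ w (lookup-⁅⁆-other w≢u))

-- If a fractional cover t of H vanishes at u and e ∈ H, then every fractional matching of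
-- H - (e ∖ {u}) weighs at most Σ t - 1: the restricted cover has lost the weight of e, which is ≥ 1.
deletionBound : ∀ {n} (H : Hypergraph n) (t : Fin n → ℚ) → IsFracCover H t →
  ∀ e u → e ∈ᴸ H → t u ≡ 0ℚ → ∀ g → IsFracMatching (H -ᴴ (e ─ ⁅ u ⁆)) g →
  total (H -ᴴ (e ─ ⁅ u ⁆)) g + 1ℚ ≤ sumFin n t
deletionBound {n} H t t-cover e u e∈H tu≡0 g g-matching = begin
  total (H -ᴴ S) g + 1ℚ
    ≤⟨ +-mono-≤ (weakDuality (H -ᴴ S) g (offSet S t) g-matching (restrictCover H S t t-cover))
                (subst (1ℚ ≤_) (sym (weightOn-remove e t u tu≡0)) (proj₂ t-cover e e∈H)) ⟩
  sumFin n (offSet S t) + weightOn S t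
    ≡⟨ sym (sumFin-split S t) ⟩
  sumFin n t ∎
  where
  open ≤-Reasoning
  S = e ─ ⁅ u ⁆

≤-minus-one : ∀ {p q} → p + 1ℚ ≤ q → p ≤ q - 1ℚ
≤-minus-one {p} {q} h =
  subst (_≤ q - 1ℚ) (solve 1 (λ p → p :+ con 1ℚ :- con 1ℚ := p) refl p) (+-monoˡ-≤ (- 1ℚ) h)

removalInequality : ∀ {n} (H : Hypergraph n) (t : Fin n → ℚ) → IsFracCover H t →
  ∀ μ → IsFracMatching H μ → sumFin n t ≤ total H μ → ∀ e u → e ∈ᴸ H → t u ≡ 0ℚ →
  ∀ x y → IsFracMatchingNumber H x → IsFracMatchingNumber (H -ᴴ (e ─ ⁅ u ⁆)) y → y ≤ x - 1ℚ
removalInequality {n} H t t-cover μ μ-matching t≤μ e u e∈H tu≡0 x y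
                  (_ , x-max) ((g , g-matching , refl) , _) = ≤-minus-one (begin
  total (H -ᴴ (e ─ ⁅ u ⁆)) g + 1ℚ ≤⟨ deletionBound H t t-cover e u e∈H tu≡0 g g-matching ⟩
  sumFin n t                       ≤⟨ t≤μ ⟩
  total H μ                        ≤⟨ x-max μ μ-matching ⟩
  x                                ∎)
  where open ≤-Reasoning

covered : ∀ {n} → Hypergraph n → Fin n → Bool
covered H w = any (λ e → lookup e w) H

covered-intro : ∀ {n} (H : Hypergraph n) {e w} → e ∈ᴸ H → lookup e w ≡ true → covered H w ≡ true
covered-intro H e∈H w∈e =
  Equivalence.to T-≡ (any⁺ _ (Any.map (λ { refl → Equivalence.from T-≡ w∈e }) e∈H))

covered-elim : ∀ {n} (H : Hypergraph n) w → covered H w ≡ true →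
  Σ (Subset n) λ e → e ∈ᴸ H × lookup e w ≡ true
covered-elim H w w-covered with find (any⁻ _ H (Equivalence.from T-≡ w-covered))
... | e , e∈H , w∈e = e , e∈H , Equivalence.to T-≡ w∈e

module Sides {r n} (H : Hypergraph n) (partite : IsRPartite r H) where

  side : Fin n → Fin r
  side = proj₁ partite

  onSide : Fin r → Fin n → Bool
  onSide s w = does (side w ≟F s) ∧ covered H w

  onSide-side : ∀ s w → onSide s w ≡ true → side w ≡ s
  onSide-side s w w∈s with side w ≟F s
  ... | yes sw≡s = sw≡s

  onSide-covered : ∀ s w → onSide s w ≡ true → covered H w ≡ true
  onSide-covered s w w∈s with does (side w ≟F s)
  ... | true = w∈s

  onSide-intro : ∀ s w → side w ≡ s → covered H w ≡ true → onSide s w ≡ true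
  onSide-intro s w sw≡s w-covered with side w ≟F s
  ... | yes _    = w-covered
  ... | no sw≢s = ⊥-elim (sw≢s sw≡s)

  sides-disjoint : ∀ s s' → ¬ s ≡ s' → ∀ w → onSide s w ≡ true → onSide s' w ≡ false
  sides-disjoint s s' s≢s' w w∈s with side w ≟F s'
  ... | yes sw≡s' = ⊥-elim (s≢s' (trans (sym (onSide-side s w w∈s)) sw≡s'))
  ... | no _      = refl

  meets-once : ∀ s e → e ∈ᴸ H → weightOn e (χ (onSide s)) ≡ 1ℚ
  meets-once s e e∈H with proj₂ partite e e∈H s
  ... | v , v∈e , sv≡s , unique = trans (sumFin-point n _ v others) at-v
    where
    others : ∀ w → ¬ w ≡ v → ind (lookup e w) (χ (onSide s) w) ≡ 0ℚ
    others w w≢v with lookup e w in w∈e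
    ... | false = refl
    ... | true with side w ≟F s
    ...   | yes sw≡s = ⊥-elim (w≢v (unique w (lookup⇒[]= w e w∈e) sw≡s))
    ...   | no _     = refl
    at-v : ind (lookup e v) (χ (onSide s) v) ≡ 1ℚ
    at-v rewrite []=⇒lookup v∈e | onSide-intro s v sv≡s (covered-intro H e∈H ([]=⇒lookup v∈e)) = refl

  inhabited : ∀ {e₀} → e₀ ∈ᴸ H → ∀ s → Σ (Fin n) λ w → onSide s w ≡ true
  inhabited e₀∈H s with proj₂ partite _ e₀∈H s
  ... | v , v∈e₀ , sv≡s , _ = v , onSide-intro s v sv≡s (covered-intro H e₀∈H ([]=⇒lookup v∈e₀))

  nonempty : Fin r → ∀ e → e ∈ᴸ H → Σ (Fin n) λ w → lookup e w ≡ true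
  nonempty s e e∈H with proj₂ partite e e∈H s
  ... | v , v∈e , _ = v , []=⇒lookup v∈e

  largerSide : ∀ s s' → ¬ s ≡ s' → Σ (Fin r) λ a → Σ (Fin r) λ b →
    ¬ a ≡ b × sumFin n (χ (onSide b)) ≤ sumFin n (χ (onSide a))
  largerSide s s' s≢s' with ≤-total (sumFin n (χ (onSide s))) (sumFin n (χ (onSide s')))
  ... | inj₁ s≤s' = s' , s , s≢s' ∘ sym , s≤s'
  ... | inj₂ s'≤s = s , s' , s≢s' , s'≤s

theorem29 : (r n : ℕ) → 2 ℕ.≤ r → (H : Hypergraph n) → IsRPartite r H →
    Σ (Subset n) (λ e → e ∈ᴸ H) →
    Σ (Subset n) λ e → Σ (Fin n) λ v → e ∈ᴸ H × v ∈ e ×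
    (∀ (x y : ℚ) → IsFracMatchingNumber H x → IsFracMatchingNumber (H -ᴴ (e ─ ⁅ v ⁆)) y →
    y ≤ x - 1ℚ)
theorem29 (suc (suc r)) n (s≤s (s≤s _)) H partite (e₀ , e₀∈H) =
  let (t , μ , μ-matching , t-cover , t≤μ) = Duality.strongDuality H (nonempty fz)
      (a , b , a≢b , |B|≤|A|)              = largerSide fz (fs fz) (λ ())
      (u , u∈A , u-min)                    = argminOn n t (onSide a) (inhabited e₀∈H a)
      (t' , t'-cover , t'u≡0 , t'≤t)       =
        Shift.shiftedCover H (onSide a) (onSide b) (meets-once a) (meets-once b)
                           (sides-disjoint a b a≢b) |B|≤|A| t t-cover u u∈A u-min
      (e , e∈H , u∈e)                      = covered-elim H u (onSide-covered a u u∈A)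
  in e , u , e∈H , lookup⇒[]= u e u∈e ,
     removalInequality H t' t'-cover μ μ-matching (≤-trans t'≤t t≤μ) e u e∈H t'u≡0
  where open Sides H partite
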